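{- Let $G=(V,A)$ be an Eulerian digraph (possibly with loops), $s\in V$, and $\mathcal{C}$ the set of recurrent configurations of $G$ with respect to sink $s$. Let $e,e'$ be two arcs which are reverse of each other, are not loops, and with $\mathrm{tail}(e)=s$. Let $H=(V,A\setminus\{e,e'\})$ and $w=\mathrm{head}(e)$. If $H$ is connected, then $\{c\in\mathcal{C}: c(w)<\deg^+_G(w)-1\}$ is exactly the set of recurrent configurations of $H$ with respect to sink $s$.
   Context: $G$ is a finite multi-digraph, loops allowed; $\deg_G(u,w)$ is the number of arcs from $u$ to $w$; out-degree $\deg^+_G(v)$ counts loops. $G$ is Eulerian if connected and in-degree equals out-degree at every vertex. Arc $e$ is a reverse of $e'$ if $\mathrm{tail}(e)=\mathrm{head}(e')$ and $\mathrm{head}(e)=\mathrm{tail}(e')$. Chip-firing game with sink $s$: configurations are maps $c:V\setminus\{s\}\to\mathbb{N}$; $v\ne s$ is firable if $c(v)\ge\deg^+_G(v)$ and $\deg^+_G(v)-\deg_G(v,v)\ge1$; firing $v$ decreases $c(v)$ by $\deg^+_G(v)-\deg_G(v,v)$ and increases $c(w)$ by $\deg_G(v,w)$ for each $w\notin\{v,s\}$; $s$ never fires. Repeated firing yields a unique stable configuration $c^\circ$. A stable $c$ is recurrent if for every configuration $d$ there is a configuration $d'$ with $(d+d')^\circ=c$. -}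

module Defs where

open import Data.Nat using (ℕ; _+_; _∸_; _≤_; _<_)
open import Data.Fin using (Fin; _≟_)
open import Data.List using (map; allFin)
open import Data.Nat.ListAction using (sum)
open import Data.Product using (Σ; _×_; ∃)
open import Data.Sum using (_⊎_)
open import Relation.Nullary using (¬_; yes; no)
open import Relation.Binary.PropositionalEquality using (_≡_; _≢_)
open import Relation.Binary.Construct.Closure.ReflexiveTransitive using (Star)

-- A finite multi-digraph (loops allowed) on vertex set Fin n, given by its
-- arc multiplicities: deg G u w = number of arcs from u to w.
Digraph : ℕ → Set
Digraph n = Fin n → Fin n → ℕ

module _ {n : ℕ} (G : Digraph n) where

  outdeg : Fin n → ℕ
  outdeg v = sum (map (G v) (allFin n))

  indeg : Fin n → ℕ
  indeg v = sum (map (λ u → G u v) (allFin n))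

  Adj : Fin n → Fin n → Set
  Adj u v = (1 ≤ G u v) ⊎ (1 ≤ G v u)

  Connected : Set
  Connected = (u v : Fin n) → Star Adj u v

  Eulerian : Set
  Eulerian = Connected × ((v : Fin n) → indeg v ≡ outdeg v)

-- Remove one arc from a to b (assumes G a b ≥ 1 when used).
removeArc : ∀ {n} → Digraph n → Fin n → Fin n → Digraph n
removeArc G a b x y with x ≟ a | y ≟ b
... | yes _ | yes _ = G x y ∸ 1
... | _     | _     = G x y

-- Configurations: maps V → ℕ; the value at the sink is ignored by every
-- notion below (so they represent maps V ∖ {s} → ℕ).
Config : ℕ → Set
Config n = Fin n → ℕ

module ChipFiring {n : ℕ} (G : Digraph n) (s : Fin n) where

  Firable : Config n → Fin n → Set
  Firable c v = (v ≢ s) × (outdeg G v ≤ c v) × (1 ≤ outdeg G v ∸ G v v)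

  fire : Config n → Fin n → Config n
  fire c v u with u ≟ v | u ≟ s
  ... | yes _ | _     = c u ∸ (outdeg G v ∸ G v v)
  ... | no _  | yes _ = c u
  ... | no _  | no _  = c u + G v u

  Step : Config n → Config n → Set
  Step c c' = Σ (Fin n) λ v → Firable c v × (c' ≡ fire c v)

  Reaches : Config n → Config n → Set
  Reaches = Star Step

  Stable : Config n → Set
  Stable c = (v : Fin n) → ¬ Firable c v

  _≈_ : Config n → Config n → Set
  c ≈ d = (u : Fin n) → u ≢ s → c u ≡ d u

  StabilizesTo : Config n → Config n → Set
  StabilizesTo c d = Σ (Config n) λ c' → Reaches c c' × Stable c' × (c' ≈ d)

  _⊕_ : Config n → Config n → Config n
  (c ⊕ d) u = c u + d u

  Recurrent : Config n → Set
  Recurrent c = Stable c × ((d : Config n) → ∃ λ d' → StabilizesTo (d ⊕ d') c)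

-- On an Eulerian digraph a configuration c is recurrent iff it is stable and has no forbidden set:
-- a nonempty set T of non-sink vertices on which every u holds fewer chips than there are arcs from T
-- into u. A forbidden set survives firings backwards, so it cannot exist after stabilising a
-- configuration with in-degree many chips everywhere. Conversely, without forbidden sets every set A
-- of non-sink vertices can be burnt: adding one chip per arc entering A lets each vertex of A fire
-- once, after which c is restored plus one chip at the head of every arc leaving A. Since an Eulerian
-- cut is entered as often as it is left, repeated burning shows that c absorbs a chip on every vertex,
-- hence every configuration.
--
-- Removing the 2-cycle s ⇄ w leaves forbidden sets (which avoid s) and their in-degrees unchanged, and
-- lowers only the out-degree of w among non-sink vertices, by one; this is the extra bound on c w.

module Submission where

open import Defs
open import Data.Bool using (Bool; true; false; not; _∧_; _∨_; if_then_else_) renaming (_≟_ to _≟ᵇ_)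
open import Data.Bool.Properties using (∨-zeroʳ; ∨-identityʳ)
open import Data.Fin using (Fin; zero; suc; _≟_)
open import Data.Fin.Properties using (any?)
open import Data.List using (map; allFin; tabulate)
open import Data.List.Properties using (map-tabulate)
import Data.Nat.ListAction as List
open import Data.Nat using (ℕ; zero; suc; _+_; _*_; _∸_; _≤_; _<_; z≤n; s≤s; s≤s⁻¹; _≤?_)
open import Data.Nat.Properties hiding (_≟_)
open import Algebra.Properties.CommutativeMonoid.Sum +-0-commutativeMonoid
  using (sum; sum-cong-≗; ∑-distrib-+; ∑-comm; sum-replicate-zero)
open import Algebra.Properties.CommutativeSemigroup +-commutativeSemigroup
  using (interchange; xy∙z≈xz∙y; x∙yz≈y∙xz; x∙yz≈xz∙y)
open import Data.Product using (∃; ∃₂; _×_; _,_; proj₁; proj₂)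
open import Data.Sum using (inj₁; inj₂)
open import Function using (_∘_; id; _⇔_; mk⇔; Equivalence)
open import Function.Properties.Equivalence using () renaming (refl to ⇔-refl; sym to ⇔-sym; trans to ⇔-trans)
open import Data.Product.Function.NonDependent.Propositional using (_×-⇔_)
open import Function.Related.Propositional using (module EquationalReasoning)
open import Relation.Binary.Construct.Closure.ReflexiveTransitive using (Star; ε; _◅_; _◅◅_)
open import Relation.Binary.PropositionalEquality
open import Relation.Nullary using (¬_; yes; no; does; Dec; contradiction; _×-dec_)
open import Relation.Nullary.Decidable using (dec-true; dec-false; ¬?)

private
  variable
    n : ℕ

sum-tabulate : (f : Fin n → ℕ) → List.sum (tabulate f) ≡ sum f
sum-tabulate {zero}  f = refl
sum-tabulate {suc n} f = cong (f zero +_) (sum-tabulate (f ∘ suc))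

sum-allFin : (f : Fin n → ℕ) → List.sum (map f (allFin n)) ≡ sum f
sum-allFin f = trans (cong List.sum (map-tabulate id f)) (sum-tabulate f)

sum-mono-≤ : {f g : Fin n → ℕ} → (∀ i → f i ≤ g i) → sum f ≤ sum g
sum-mono-≤ {zero}  f≤g = z≤n
sum-mono-≤ {suc n} f≤g = +-mono-≤ (f≤g zero) (sum-mono-≤ (f≤g ∘ suc))

VSet : ℕ → Set
VSet n = Fin n → Bool

∅ : VSet n
∅ _ = false

⁅_⁆ : Fin n → VSet n
⁅ v ⁆ t = does (t ≟ v)

∁ : VSet n → VSet n
∁ P t = not (P t)

_∪_ _∖_ : VSet n → VSet n → VSet n
(P ∪ Q) t = P t ∨ Q t
(P ∖ Q) t = P t ∧ not (Q t)

_⊆_ : VSet n → VSet n → Set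
P ⊆ Q = ∀ t → P t ≡ true → Q t ≡ true

⁅⁆-self : (v : Fin n) → ⁅ v ⁆ v ≡ true
⁅⁆-self v = dec-true (v ≟ v) refl

⁅⁆-other : {t v : Fin n} → t ≢ v → ⁅ v ⁆ t ≡ false
⁅⁆-other {t = t} {v} = dec-false (t ≟ v)

⁅⁆-sound : {t v : Fin n} → ⁅ v ⁆ t ≡ true → t ≡ v
⁅⁆-sound {t = t} {v} t∈⁅v⁆ with t ≟ v
⁅⁆-sound t∈⁅v⁆ | yes t≡v = t≡v

⁅⁆-∉ : {t v : Fin n} → ⁅ v ⁆ t ≡ false → t ≢ v
⁅⁆-∉ {v = v} t∉⁅v⁆ refl = contradiction (trans (sym (⁅⁆-self v)) t∉⁅v⁆) λ ()

⁅⁆-⊆ : {P : VSet n} {v : Fin n} → P v ≡ true → ⁅ v ⁆ ⊆ P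
⁅⁆-⊆ {v = v} Pv t t∈⁅v⁆ with t ≟ v
⁅⁆-⊆ Pv t t∈⁅v⁆ | yes refl = Pv

∪-⊆ : {P Q R : VSet n} → P ⊆ R → Q ⊆ R → (P ∪ Q) ⊆ R
∪-⊆ {P = P} P⊆R Q⊆R t t∈P∪Q with P t in eP
... | true  = P⊆R t eP
... | false = Q⊆R t t∈P∪Q

∖-⊆ : {P Q : VSet n} → (P ∖ Q) ⊆ P
∖-⊆ {P = P} t t∈P∖Q with P t
... | true = refl

∖-∉ : {P Q : VSet n} {t : Fin n} → (P ∖ Q) t ≡ true → Q t ≡ false
∖-∉ {P = P} {Q} {t} t∈P∖Q with P t | Q t
... | true | false = refl

∈-∖ : {P Q : VSet n} {t : Fin n} → P t ≡ true → Q t ≡ false → (P ∖ Q) t ≡ true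
∈-∖ Pt Qt rewrite Pt | Qt = refl

_↾_ : (Fin n → ℕ) → VSet n → Fin n → ℕ
(f ↾ P) t = if P t then f t else 0

∑⟨_⟩ : VSet n → (Fin n → ℕ) → ℕ
∑⟨ P ⟩ f = sum (f ↾ P)

𝟙 : VSet n → Fin n → ℕ
𝟙 P = (λ _ → 1) ↾ P

size : VSet n → ℕ
size P = sum (𝟙 P)

↾-∈ : {P : VSet n} {t : Fin n} (f : Fin n → ℕ) → P t ≡ true → (f ↾ P) t ≡ f t
↾-∈ f Pt rewrite Pt = refl

↾-∉ : {P : VSet n} {t : Fin n} (f : Fin n → ℕ) → P t ≡ false → (f ↾ P) t ≡ 0
↾-∉ f Pt rewrite Pt = refl

𝟙⁅⁆-self : (v : Fin n) → 𝟙 ⁅ v ⁆ v ≡ 1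
𝟙⁅⁆-self v = ↾-∈ {P = ⁅ v ⁆} {t = v} (λ _ → 1) (⁅⁆-self v)

𝟙⁅⁆-other : {t v : Fin n} → t ≢ v → 𝟙 ⁅ v ⁆ t ≡ 0
𝟙⁅⁆-other {t = t} {v} t≢v = ↾-∉ {P = ⁅ v ⁆} {t = t} (λ _ → 1) (⁅⁆-other t≢v)

↾-∪⁅⁆-self : (P : VSet n) (v : Fin n) (f : Fin n → ℕ) → (f ↾ (P ∪ ⁅ v ⁆)) v ≡ f v
↾-∪⁅⁆-self P v f rewrite ⁅⁆-self v | ∨-zeroʳ (P v) = refl

↾-∪⁅⁆-other : (P : VSet n) {t v : Fin n} (f : Fin n → ℕ) → t ≢ v → (f ↾ (P ∪ ⁅ v ⁆)) t ≡ (f ↾ P) t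
↾-∪⁅⁆-other P {t} f t≢v rewrite ⁅⁆-other t≢v | ∨-identityʳ (P t) = refl

𝟙-∪ : (P Q : VSet n) (t : Fin n) → 𝟙 (P ∪ Q) t ≤ 𝟙 P t + 𝟙 Q t
𝟙-∪ P Q t with P t | Q t
... | true  | _     = s≤s z≤n
... | false | true  = ≤-refl
... | false | false = z≤n

if-sum : ∀ b (g : Fin n → ℕ) → (if b then sum g else 0) ≡ sum (λ j → if b then g j else 0)
if-sum true  g = refl
if-sum {n} false g = sym (sum-replicate-zero n)

∑⟨⟩-cong : {P Q : VSet n} {f g : Fin n → ℕ} → (∀ t → P t ≡ Q t) → (∀ t → Q t ≡ true → f t ≡ g t) →
           ∑⟨ P ⟩ f ≡ ∑⟨ Q ⟩ g
∑⟨⟩-cong {P = P} {Q} {f} {g} P≗Q f≗g = sum-cong-≗ pointwise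
  where
  pointwise : ∀ t → (if P t then f t else 0) ≡ (if Q t then g t else 0)
  pointwise t rewrite P≗Q t with Q t in eq
  ... | true  = f≗g t eq
  ... | false = refl

∑⟨∅⟩ : (f : Fin n → ℕ) → ∑⟨ ∅ ⟩ f ≡ 0
∑⟨∅⟩ {n} f = sum-replicate-zero n

∑⟨⁅⁆⟩ : (v : Fin n) (f : Fin n → ℕ) → ∑⟨ ⁅ v ⁆ ⟩ f ≡ f v
∑⟨⁅⁆⟩ {suc n} zero f = trans (cong (f zero +_) (sum-replicate-zero n)) (+-identityʳ (f zero))
∑⟨⁅⁆⟩ {suc n} (suc v) f = ∑⟨⁅⁆⟩ v (f ∘ suc)

∑⟨⟩-∪ : {P Q : VSet n} (f : Fin n → ℕ) → (∀ t → Q t ≡ true → P t ≡ false) →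
        ∑⟨ P ∪ Q ⟩ f ≡ ∑⟨ P ⟩ f + ∑⟨ Q ⟩ f
∑⟨⟩-∪ {P = P} {Q} f disjoint = trans (sum-cong-≗ pointwise) (∑-distrib-+ (f ↾ P) (f ↾ Q))
  where
  pointwise : ∀ t → (if P t ∨ Q t then f t else 0) ≡ (if P t then f t else 0) + (if Q t then f t else 0)
  pointwise t with P t in eP | Q t in eQ
  ... | true  | true  = contradiction (trans (sym eP) (disjoint t eQ)) λ ()
  ... | true  | false = sym (+-identityʳ (f t))
  ... | false | _     = refl

∑⟨⟩-∁ : (P : VSet n) (f : Fin n → ℕ) → ∑⟨ P ⟩ f + ∑⟨ ∁ P ⟩ f ≡ sum f
∑⟨⟩-∁ P f = trans (sym (∑-distrib-+ (f ↾ P) (f ↾ ∁ P))) (sum-cong-≗ pointwise)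
  where
  pointwise : ∀ t → (if P t then f t else 0) + (if not (P t) then f t else 0) ≡ f t
  pointwise t with P t
  ... | true  = +-identityʳ (f t)
  ... | false = refl

∑⟨⟩-distrib-+ : (P : VSet n) (f g : Fin n → ℕ) → ∑⟨ P ⟩ (λ t → f t + g t) ≡ ∑⟨ P ⟩ f + ∑⟨ P ⟩ g
∑⟨⟩-distrib-+ P f g = trans (sum-cong-≗ pointwise) (∑-distrib-+ (f ↾ P) (g ↾ P))
  where
  pointwise : ∀ t → (if P t then f t + g t else 0) ≡ (if P t then f t else 0) + (if P t then g t else 0)
  pointwise t with P t
  ... | true  = refl
  ... | false = refl

∑⟨⟩-mono-⊆ : {P Q : VSet n} (f : Fin n → ℕ) → P ⊆ Q → ∑⟨ P ⟩ f ≤ ∑⟨ Q ⟩ f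
∑⟨⟩-mono-⊆ {P = P} {Q} f P⊆Q = sum-mono-≤ pointwise
  where
  pointwise : ∀ t → (if P t then f t else 0) ≤ (if Q t then f t else 0)
  pointwise t with P t in eP
  ... | false = z≤n
  ... | true rewrite P⊆Q t eP = ≤-refl

∑⟨⟩-≤-sum : {P : VSet n} (f : Fin n → ℕ) → ∑⟨ P ⟩ f ≤ sum f
∑⟨⟩-≤-sum f = ∑⟨⟩-mono-⊆ f λ _ _ → refl

≤-∑⟨⟩ : {P : VSet n} (f : Fin n → ℕ) {t : Fin n} → P t ≡ true → f t ≤ ∑⟨ P ⟩ f
≤-∑⟨⟩ {P = P} f {t} Pt = ≤-trans (≤-reflexive (sym (∑⟨⁅⁆⟩ t f))) (∑⟨⟩-mono-⊆ f (⁅⁆-⊆ {P = P} Pt))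

≤-sum : (f : Fin n → ℕ) (t : Fin n) → f t ≤ sum f
≤-sum f t = ≤-∑⟨⟩ {P = λ _ → true} f refl

∑⟨⟩-comm : (P Q : VSet n) (f : Fin n → Fin n → ℕ) →
           ∑⟨ P ⟩ (λ i → ∑⟨ Q ⟩ (f i)) ≡ ∑⟨ Q ⟩ (λ j → ∑⟨ P ⟩ (λ i → f i j))
∑⟨⟩-comm P Q f = begin
  ∑⟨ P ⟩ (λ i → ∑⟨ Q ⟩ (f i))                                 ≡⟨ sum-cong-≗ (λ i → if-sum (P i) (term i)) ⟩
  sum (λ i → sum (λ j → if P i then term i j else 0))          ≡⟨ ∑-comm (λ i j → if P i then term i j else 0) ⟩
  sum (λ j → sum (λ i → if P i then term i j else 0))          ≡⟨ sum-cong-≗ (λ j → sum-cong-≗ (λ i → swap (P i) (Q j))) ⟩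
  sum (λ j → sum (λ i → if Q j then (if P i then f i j else 0) else 0)) ≡⟨ sum-cong-≗ (λ j → if-sum (Q j) (λ i → if P i then f i j else 0)) ⟨
  ∑⟨ Q ⟩ (λ j → ∑⟨ P ⟩ (λ i → f i j))                         ∎
  where
  open ≡-Reasoning
  term : Fin _ → Fin _ → ℕ
  term i j = if Q j then f i j else 0
  swap : ∀ {x} a b → (if a then (if b then x else 0) else 0) ≡ (if b then (if a then x else 0) else 0)
  swap true  b     = refl
  swap false true  = refl
  swap false false = refl

∑⟨⟩-positive : (P : VSet n) (f : Fin n → ℕ) → 1 ≤ ∑⟨ P ⟩ f → ∃ λ t → P t ≡ true × 1 ≤ f t
∑⟨⟩-positive {n} P f 1≤∑ with any? (λ t → (P t ≟ᵇ true) ×-dec (1 ≤? f t))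
... | yes witness = witness
... | no none     = contradiction (≤-trans 1≤∑ (≤-trans (sum-mono-≤ pointwise) (≤-reflexive (sum-replicate-zero n)))) λ ()
  where
  pointwise : ∀ t → (if P t then f t else 0) ≤ 0
  pointwise t with P t in eP
  ... | false = z≤n
  ... | true  = ≤-reflexive (n<1⇒n≡0 (≰⇒> λ 1≤ft → none (t , eP , 1≤ft)))

∑⟨⟩-insert : {P : VSet n} {v : Fin n} (f : Fin n → ℕ) → P v ≡ false → ∑⟨ P ∪ ⁅ v ⁆ ⟩ f ≡ ∑⟨ P ⟩ f + f v
∑⟨⟩-insert {P = P} {v} f v∉P = trans (∑⟨⟩-∪ {P = P} f disjoint) (cong (∑⟨ P ⟩ f +_) (∑⟨⁅⁆⟩ v f))
  where
  disjoint : ∀ t → ⁅ v ⁆ t ≡ true → P t ≡ false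
  disjoint t t∈⁅v⁆ = subst (λ u → P u ≡ false) (sym (⁅⁆-sound t∈⁅v⁆)) v∉P

+-≤-sum : (f : Fin n → ℕ) {i j : Fin n} → i ≢ j → f i + f j ≤ sum f
+-≤-sum f {i} {j} i≢j = begin
  f i + f j                ≡⟨ cong₂ _+_ (∑⟨⁅⁆⟩ i f) refl ⟨
  ∑⟨ ⁅ i ⁆ ⟩ f + f j       ≡⟨ ∑⟨⟩-insert {P = ⁅ i ⁆} f (⁅⁆-other (i≢j ∘ sym)) ⟨
  ∑⟨ ⁅ i ⁆ ∪ ⁅ j ⁆ ⟩ f     ≤⟨ ∑⟨⟩-≤-sum {P = ⁅ i ⁆ ∪ ⁅ j ⁆} f ⟩
  sum f                    ∎
  where open ≤-Reasoning

∑⟨⟩-≤-remove : {P : VSet n} (v : Fin n) (f : Fin n → ℕ) → ∑⟨ P ⟩ f ≤ ∑⟨ P ∖ ⁅ v ⁆ ⟩ f + f v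
∑⟨⟩-≤-remove {P = P} v f = ≤-trans (∑⟨⟩-mono-⊆ f P⊆) (≤-reflexive (∑⟨⟩-insert {P = P ∖ ⁅ v ⁆} f v∉P∖v))
  where
  v∉P∖v : (P ∖ ⁅ v ⁆) v ≡ false
  v∉P∖v rewrite ⁅⁆-self v with P v
  ... | true  = refl
  ... | false = refl
  P⊆ : P ⊆ ((P ∖ ⁅ v ⁆) ∪ ⁅ v ⁆)
  P⊆ t Pt with t ≟ v
  ... | yes _ rewrite Pt = refl
  ... | no  _ rewrite Pt = refl

∑⟨⟩-partition : {A F : VSet n} (f : Fin n → ℕ) → F ⊆ A → ∑⟨ ∁ A ⟩ f + ∑⟨ F ⟩ f + ∑⟨ A ∖ F ⟩ f ≡ sum f
∑⟨⟩-partition {A = A} {F} f F⊆A = begin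
  ∑⟨ ∁ A ⟩ f + ∑⟨ F ⟩ f + ∑⟨ A ∖ F ⟩ f                 ≡⟨ cong (_+ ∑⟨ A ∖ F ⟩ f) (∑-distrib-+ (f ↾ ∁ A) (f ↾ F)) ⟨
  sum (λ t → (f ↾ ∁ A) t + (f ↾ F) t) + ∑⟨ A ∖ F ⟩ f   ≡⟨ ∑-distrib-+ (λ t → (f ↾ ∁ A) t + (f ↾ F) t) (f ↾ (A ∖ F)) ⟨
  sum (λ t → (f ↾ ∁ A) t + (f ↾ F) t + (f ↾ (A ∖ F)) t) ≡⟨ sum-cong-≗ pointwise ⟩
  sum f                                                ∎
  where
  open ≡-Reasoning
  pointwise : ∀ t → (f ↾ ∁ A) t + (f ↾ F) t + (f ↾ (A ∖ F)) t ≡ f t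
  pointwise t with A t in eA | F t in eF
  ... | true  | true  = +-identityʳ (f t)
  ... | true  | false = refl
  ... | false | true  = contradiction (trans (sym (F⊆A t eF)) eA) λ ()
  ... | false | false = trans (+-identityʳ (f t + 0)) (+-identityʳ (f t))

saturate : (A : VSet n) (Q : VSet n → Set) →
           (∀ F → F ⊆ A → Q F → ∃ (λ u → (A ∖ F) u ≡ true) → ∃ λ v → (A ∖ F) v ≡ true × Q (F ∪ ⁅ v ⁆)) →
           Q ∅ → ∃ λ F → (∀ t → F t ≡ A t) × Q F
saturate {n} A Q extend Q∅ = go (size A) ∅ (λ _ ()) (≤-reflexive (cong (_+ size A) (sym size-∅))) Q∅
  where
  size-∅ : size {n} ∅ ≡ 0
  size-∅ = ∑⟨∅⟩ {n} (λ _ → 1)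
  go : ∀ k F → F ⊆ A → size A ≤ size F + k → Q F → ∃ λ F → (∀ t → F t ≡ A t) × Q F
  go k F F⊆A bound QF with any? (λ u → (A ∖ F) u ≟ᵇ true)
  ... | no A⊆F = F , F≗A , QF
    where
    F≗A : ∀ t → F t ≡ A t
    F≗A t with F t in eF | A t in eA
    ... | true  | true  = refl
    ... | true  | false = contradiction (trans (sym (F⊆A t eF)) eA) λ ()
    ... | false | true  = contradiction (t , ∈-∖ {P = A} {Q = F} eA eF) A⊆F
    ... | false | false = refl
  ... | yes u∈A∖F with extend F F⊆A QF u∈A∖F
  ...   | v , v∈A∖F , QF′ = next k bound
    where
    F′⊆A : (F ∪ ⁅ v ⁆) ⊆ A
    F′⊆A = ∪-⊆ {P = F} {Q = ⁅ v ⁆} F⊆A (⁅⁆-⊆ (∖-⊆ {P = A} {Q = F} v v∈A∖F))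
    size-F′ : size (F ∪ ⁅ v ⁆) ≡ suc (size F)
    size-F′ = trans (∑⟨⟩-insert {P = F} (λ _ → 1) (∖-∉ {P = A} {Q = F} v∈A∖F)) (+-comm (size F) 1)
    size-F′≤A : suc (size F) ≤ size A
    size-F′≤A = subst (_≤ size A) size-F′ (∑⟨⟩-mono-⊆ {P = F ∪ ⁅ v ⁆} {Q = A} (λ _ → 1) F′⊆A)
    next : ∀ k → size A ≤ size F + k → ∃ λ F → (∀ t → F t ≡ A t) × Q F
    next zero    bound = contradiction (≤-trans size-F′≤A (subst (size A ≤_) (+-identityʳ (size F)) bound)) (n≮n (size F))
    next (suc k) bound = go k (F ∪ ⁅ v ⁆) F′⊆A bound′ QF′
      where
      bound′ : size A ≤ size (F ∪ ⁅ v ⁆) + k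
      bound′ = subst (size A ≤_) (trans (+-suc (size F) k) (cong (_+ k) (sym size-F′))) bound

degFrom : Digraph n → VSet n → Fin n → ℕ
degFrom K P u = ∑⟨ P ⟩ (λ t → K t u)

outdeg-sum : (K : Digraph n) (v : Fin n) → outdeg K v ≡ sum (K v)
outdeg-sum K v = sum-allFin (K v)

indeg-sum : (K : Digraph n) (v : Fin n) → indeg K v ≡ sum (λ t → K t v)
indeg-sum K v = sum-allFin (λ t → K t v)

indeg-split : (K : Digraph n) (P : VSet n) (v : Fin n) → indeg K v ≡ degFrom K P v + degFrom K (∁ P) v
indeg-split K P v = trans (indeg-sum K v) (sym (∑⟨⟩-∁ P (λ t → K t v)))

loops≤outdeg : (K : Digraph n) (v : Fin n) → K v v ≤ outdeg K v
loops≤outdeg K v = ≤-trans (≤-sum (K v) v) (≤-reflexive (sym (outdeg-sum K v)))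

crossing-arc : (K : Digraph n) (A : VSet n) {x y : Fin n} → Star (Adj K) x y → A x ≡ true → A y ≡ false →
               ∃₂ λ a b → A a ≡ true × A b ≡ false × Adj K a b
crossing-arc K A ε Ax Ay = contradiction (trans (sym Ax) Ay) λ ()
crossing-arc K A {x} (_◅_ {j = z} x~z path) Ax Ay with A z in Az
... | true  = crossing-arc K A path Az Ay
... | false = x , z , Ax , Az , x~z

outdeg∸loops-positive : (K : Digraph n) → Eulerian K → {u v : Fin n} → v ≢ u → 1 ≤ outdeg K v ∸ K v v
outdeg∸loops-positive K (connected , balanced) {u} {v} v≢u
  with crossing-arc K ⁅ v ⁆ (connected v u) (⁅⁆-self v) (⁅⁆-other (v≢u ∘ sym))
... | a , b , a∈⁅v⁆ , b∉⁅v⁆ , a~b with refl ← ⁅⁆-sound {t = a} {v} a∈⁅v⁆ =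
  m+n≤o⇒m≤o∸n 1 (subst (_≤ outdeg K v) (+-comm (K v v) 1) (loop+arc a~b))
  where
  v≢b : v ≢ b
  v≢b = ⁅⁆-∉ b∉⁅v⁆ ∘ sym
  loop+arc : Adj K v b → K v v + 1 ≤ outdeg K v
  loop+arc (inj₁ 1≤Kvb) = ≤-trans (+-monoʳ-≤ (K v v) 1≤Kvb)
    (≤-trans (+-≤-sum (K v) v≢b) (≤-reflexive (sym (outdeg-sum K v))))
  loop+arc (inj₂ 1≤Kbv) = ≤-trans (+-monoʳ-≤ (K v v) 1≤Kbv)
    (≤-trans (+-≤-sum (λ t → K t v) v≢b) (≤-reflexive (trans (sym (indeg-sum K v)) (balanced v))))

removeArc-other : (G : Digraph n) {a b x y : Fin n} → ¬ (x ≡ a × y ≡ b) → removeArc G a b x y ≡ G x y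
removeArc-other G {a} {b} {x} {y} ≢ab with x ≟ a | y ≟ b
... | yes x≡a | yes y≡b = contradiction (x≡a , y≡b) ≢ab
... | yes _   | no _    = refl
... | no _    | _       = refl

module _ (G : Digraph n) {a b : Fin n} (1≤Gab : 1 ≤ G a b) where

  private
    G′ : Digraph n
    G′ = removeArc G a b

  removeArc-arc : G′ a b + 1 ≡ G a b
  removeArc-arc with a ≟ a | b ≟ b
  ... | yes _   | yes _   = m∸n+n≡m 1≤Gab
  ... | no a≢a  | _       = contradiction refl a≢a
  ... | yes _   | no b≢b  = contradiction refl b≢b

  private
    row : ∀ y → G′ a y + 𝟙 ⁅ b ⁆ y ≡ G a y
    row y = by-cases (y ≟ b)
      where
      by-cases : Dec (y ≡ b) → G′ a y + 𝟙 ⁅ b ⁆ y ≡ G a y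
      by-cases (yes refl) = trans (cong (G′ a b +_) (𝟙⁅⁆-self b)) removeArc-arc
      by-cases (no y≢b)   = trans (cong₂ _+_ (removeArc-other G {x = a} {y} (y≢b ∘ proj₂)) (𝟙⁅⁆-other y≢b)) (+-identityʳ _)

    column : ∀ x → G′ x b + 𝟙 ⁅ a ⁆ x ≡ G x b
    column x = by-cases (x ≟ a)
      where
      by-cases : Dec (x ≡ a) → G′ x b + 𝟙 ⁅ a ⁆ x ≡ G x b
      by-cases (yes refl) = trans (cong (G′ a b +_) (𝟙⁅⁆-self a)) removeArc-arc
      by-cases (no x≢a)   = trans (cong₂ _+_ (removeArc-other G {x = x} {b} (x≢a ∘ proj₁)) (𝟙⁅⁆-other x≢a)) (+-identityʳ _)

  outdeg-removeArc : ∀ x → outdeg (removeArc G a b) x + 𝟙 ⁅ a ⁆ x ≡ outdeg G x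
  outdeg-removeArc x = by-cases (x ≟ a)
    where
    open ≡-Reasoning
    by-cases : Dec (x ≡ a) → outdeg G′ x + 𝟙 ⁅ a ⁆ x ≡ outdeg G x
    by-cases (yes refl) = begin
      outdeg G′ a + 𝟙 ⁅ a ⁆ a                   ≡⟨ cong₂ _+_ (outdeg-sum G′ a) (trans (𝟙⁅⁆-self a) (sym (∑⟨⁅⁆⟩ b (λ _ → 1)))) ⟩
      sum (G′ a) + sum (𝟙 ⁅ b ⁆)                ≡⟨ ∑-distrib-+ (G′ a) (𝟙 ⁅ b ⁆) ⟨
      sum (λ y → G′ a y + 𝟙 ⁅ b ⁆ y)            ≡⟨ sum-cong-≗ row ⟩
      sum (G a)                                 ≡⟨ outdeg-sum G a ⟨
      outdeg G a                                ∎
    by-cases (no x≢a) = begin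
      outdeg G′ x + 𝟙 ⁅ a ⁆ x                   ≡⟨ cong₂ _+_ (outdeg-sum G′ x) (𝟙⁅⁆-other x≢a) ⟩
      sum (G′ x) + 0                            ≡⟨ +-identityʳ _ ⟩
      sum (G′ x)                                ≡⟨ sum-cong-≗ (λ y → removeArc-other G {x = x} {y} (x≢a ∘ proj₁)) ⟩
      sum (G x)                                 ≡⟨ outdeg-sum G x ⟨
      outdeg G x                                ∎

  indeg-removeArc : ∀ y → indeg (removeArc G a b) y + 𝟙 ⁅ b ⁆ y ≡ indeg G y
  indeg-removeArc y = by-cases (y ≟ b)
    where
    open ≡-Reasoning
    by-cases : Dec (y ≡ b) → indeg G′ y + 𝟙 ⁅ b ⁆ y ≡ indeg G y
    by-cases (yes refl) = begin
      indeg G′ b + 𝟙 ⁅ b ⁆ b                    ≡⟨ cong₂ _+_ (indeg-sum G′ b) (trans (𝟙⁅⁆-self b) (sym (∑⟨⁅⁆⟩ a (λ _ → 1)))) ⟩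
      sum (λ x → G′ x b) + sum (𝟙 ⁅ a ⁆)        ≡⟨ ∑-distrib-+ (λ x → G′ x b) (𝟙 ⁅ a ⁆) ⟨
      sum (λ x → G′ x b + 𝟙 ⁅ a ⁆ x)            ≡⟨ sum-cong-≗ column ⟩
      sum (λ x → G x b)                         ≡⟨ indeg-sum G b ⟨
      indeg G b                                 ∎
    by-cases (no y≢b) = begin
      indeg G′ y + 𝟙 ⁅ b ⁆ y                    ≡⟨ cong₂ _+_ (indeg-sum G′ y) (𝟙⁅⁆-other y≢b) ⟩
      sum (λ x → G′ x y) + 0                    ≡⟨ +-identityʳ _ ⟩
      sum (λ x → G′ x y)                        ≡⟨ sum-cong-≗ (λ x → removeArc-other G {x = x} {y} (y≢b ∘ proj₂)) ⟩
      sum (λ x → G x y)                         ≡⟨ indeg-sum G y ⟨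
      indeg G y                                 ∎

module Firing (K : Digraph n) (s : Fin n) where
  open ChipFiring K s

  fire-self : ∀ c v → fire c v v ≡ c v ∸ (outdeg K v ∸ K v v)
  fire-self c v with v ≟ v
  ... | yes _   = refl
  ... | no v≢v  = contradiction refl v≢v

  fire-other : ∀ c {u v} → u ≢ v → u ≢ s → fire c v u ≡ c u + K v u
  fire-other c {u} {v} u≢v u≢s with u ≟ v | u ≟ s
  ... | yes u≡v | _       = contradiction u≡v u≢v
  ... | no _    | yes u≡s = contradiction u≡s u≢s
  ... | no _    | no _    = refl

  firable? : ∀ c v → Dec (Firable c v)
  firable? c v = ¬? (v ≟ s) ×-dec (outdeg K v ≤? c v ×-dec 1 ≤? outdeg K v ∸ K v v)

  ≈-refl : ∀ {c} → c ≈ c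
  ≈-refl u _ = refl

  ≈-sym : ∀ {c d} → c ≈ d → d ≈ c
  ≈-sym c≈d u u≢s = sym (c≈d u u≢s)

  ≈-trans : ∀ {c d e} → c ≈ d → d ≈ e → c ≈ e
  ≈-trans c≈d d≈e u u≢s = trans (c≈d u u≢s) (d≈e u u≢s)

  fire-cong : ∀ {c d} v → c ≈ d → fire c v ≈ fire d v
  fire-cong v c≈d u u≢s with u ≟ v | u ≟ s
  ... | yes _ | _       = cong (_∸ (outdeg K v ∸ K v v)) (c≈d u u≢s)
  ... | no _  | yes u≡s = contradiction u≡s u≢s
  ... | no _  | no _    = cong (_+ K v u) (c≈d u u≢s)

  firable-cong : ∀ {c d v} → c ≈ d → Firable c v → Firable d v
  firable-cong {v = v} c≈d (v≢s , out≤cv , positive) = v≢s , subst (outdeg K v ≤_) (c≈d v v≢s) out≤cv , positive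

  stable-cong : ∀ {c d} → c ≈ d → Stable c → Stable d
  stable-cong c≈d c-stable v = c-stable v ∘ firable-cong (≈-sym c≈d)

  reaches-cong : ∀ {c c′ d} → c ≈ d → Reaches c c′ → ∃ λ d′ → Reaches d d′ × c′ ≈ d′
  reaches-cong {d = d} c≈d ε = d , ε , c≈d
  reaches-cong {c} {d = d} c≈d ((v , firable , refl) ◅ steps)
    with reaches-cong (fire-cong v c≈d) steps
  ... | d′ , steps′ , c′≈d′ = d′ , (v , firable-cong c≈d firable , refl) ◅ steps′ , c′≈d′

  infix 4 _⇝_
  _⇝_ : Config n → Config n → Set
  c ⇝ d = ∃ λ c′ → Reaches c c′ × c′ ≈ d

  ≈⇒⇝ : ∀ {c d} → c ≈ d → c ⇝ d
  ≈⇒⇝ {c} c≈d = c , ε , c≈d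

  ⇝-trans : ∀ {c d e} → c ⇝ d → d ⇝ e → c ⇝ e
  ⇝-trans (c′ , steps₁ , c′≈d) (d′ , steps₂ , d′≈e) with reaches-cong (≈-sym c′≈d) steps₂
  ... | e′ , steps₂′ , d′≈e′ = e′ , steps₁ ◅◅ steps₂′ , ≈-trans (≈-sym d′≈e′) d′≈e

  fire-⊕ : ∀ {c v} e → Firable c v → fire (c ⊕ e) v ≈ (fire c v ⊕ e)
  fire-⊕ {c} {v} e (_ , out≤cv , _) u u≢s with u ≟ v | u ≟ s
  ... | yes refl | _       = +-∸-comm (e v) (≤-trans (m∸n≤m (outdeg K v) (K v v)) out≤cv)
  ... | no _     | yes u≡s = contradiction u≡s u≢s
  ... | no _     | no _    = xy∙z≈xz∙y (c u) (e u) (K v u)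

  ⇝-⊕ : ∀ {c d} e → c ⇝ d → (c ⊕ e) ⇝ (d ⊕ e)
  ⇝-⊕ e (c′ , steps , c′≈d) = ⇝-trans (reaches-⊕ steps) (≈⇒⇝ λ u u≢s → cong (_+ e u) (c′≈d u u≢s))
    where
    reaches-⊕ : ∀ {c c′} → Reaches c c′ → (c ⊕ e) ⇝ (c′ ⊕ e)
    reaches-⊕ ε = ≈⇒⇝ ≈-refl
    reaches-⊕ {c} ((v , firable@(v≢s , out≤cv , positive) , refl) ◅ steps) =
      ⇝-trans (fire (c ⊕ e) v , (v , (v≢s , ≤-trans out≤cv (m≤m+n (c v) (e v)) , positive) , refl) ◅ ε , fire-⊕ e firable)
              (reaches-⊕ steps)

module Forbidden (K : Digraph n) (s : Fin n) where
  open ChipFiring K s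
  open Firing K s

  Forbidden : Config n → VSet n → Set
  Forbidden c T = ∃ (λ u → T u ≡ true) × (∀ u → T u ≡ true → u ≢ s) × (∀ u → T u ≡ true → c u < degFrom K T u)

  Unforbidden : Config n → Set
  Unforbidden c = ∀ T → ¬ Forbidden c T

  forbidden-cong : ∀ {c d T} → c ≈ d → Forbidden c T → Forbidden d T
  forbidden-cong c≈d (nonempty , T∌s , below) =
    nonempty , T∌s , λ u u∈T → subst (_< _) (c≈d u (T∌s u u∈T)) (below u u∈T)

  -- T ∖ ⁅ v ⁆ is forbidden before the firing; T ⊆ ⁅ v ⁆ is impossible, as v keeps its K v v loop chips.
  forbidden-fire : ∀ {c v T} → Firable c v → Forbidden (fire c v) T → ∃ (Forbidden c)
  forbidden-fire {c} {v} {T} (v≢s , out≤cv , _) (nonempty , T∌s , below)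
    with any? (λ u → (T ∖ ⁅ v ⁆) u ≟ᵇ true)
  ... | yes u∈T-v = T ∖ ⁅ v ⁆ , u∈T-v , (λ u → T∌s u ∘ ∖-⊆ {P = T} {Q = ⁅ v ⁆} u) , below′
    where
    below′ : ∀ u → (T ∖ ⁅ v ⁆) u ≡ true → c u < degFrom K (T ∖ ⁅ v ⁆) u
    below′ u u∈T-v = +-cancelʳ-< (K v u) (c u) _ (begin-strict
      c u + K v u                      ≡⟨ fire-other c (⁅⁆-∉ (∖-∉ {P = T} {Q = ⁅ v ⁆} u∈T-v)) (T∌s u u∈T) ⟨
      fire c v u                       <⟨ below u u∈T ⟩
      degFrom K T u                    ≤⟨ ∑⟨⟩-≤-remove v (λ t → K t u) ⟩
      degFrom K (T ∖ ⁅ v ⁆) u + K v u  ∎)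
      where
      open ≤-Reasoning
      u∈T : T u ≡ true
      u∈T = ∖-⊆ {P = T} {Q = ⁅ v ⁆} u u∈T-v
  ... | no T-v-empty = contradiction (below v v∈T) (≤⇒≯ (begin
      degFrom K T v                       ≤⟨ ∑⟨⟩-mono-⊆ (λ t → K t v) T⊆⁅v⁆ ⟩
      degFrom K ⁅ v ⁆ v                   ≡⟨ ∑⟨⁅⁆⟩ v (λ t → K t v) ⟩
      K v v                               ≡⟨ m∸[m∸n]≡n (loops≤outdeg K v) ⟨
      outdeg K v ∸ (outdeg K v ∸ K v v)   ≤⟨ ∸-monoˡ-≤ (outdeg K v ∸ K v v) out≤cv ⟩
      c v ∸ (outdeg K v ∸ K v v)          ≡⟨ fire-self c v ⟨
      fire c v v                          ∎))
    where
    open ≤-Reasoning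
    T⊆⁅v⁆ : T ⊆ ⁅ v ⁆
    T⊆⁅v⁆ t t∈T with ⁅ v ⁆ t in t∈⁅v⁆
    ... | true  = refl
    ... | false = contradiction (t , ∈-∖ {P = T} {Q = ⁅ v ⁆} t∈T t∈⁅v⁆) T-v-empty
    v∈T : T v ≡ true
    v∈T = let u , u∈T = nonempty in subst (λ t → T t ≡ true) (⁅⁆-sound {t = u} (T⊆⁅v⁆ u u∈T)) u∈T

  forbidden-reaches : ∀ {c d T} → Reaches c d → Forbidden d T → ∃ (Forbidden c)
  forbidden-reaches ε forbidden = _ , forbidden
  forbidden-reaches ((v , firable , refl) ◅ steps) forbidden =
    forbidden-fire firable (proj₂ (forbidden-reaches steps forbidden))

  recurrent⇒unforbidden : ∀ {c} → Recurrent c → Unforbidden c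
  recurrent⇒unforbidden (_ , reachable) T forbidden with reachable (indeg K)
  ... | d′ , c′ , steps , _ , c′≈c with forbidden-reaches steps (forbidden-cong (≈-sym c′≈c) forbidden)
  ... | T′ , (u , u∈T′) , _ , below = <⇒≱ (below u u∈T′) (begin
    degFrom K T′ u       ≤⟨ ∑⟨⟩-≤-sum {P = T′} (λ t → K t u) ⟩
    sum (λ t → K t u)    ≡⟨ indeg-sum K u ⟨
    indeg K u            ≤⟨ m≤m+n (indeg K u) (d′ u) ⟩
    indeg K u + d′ u     ∎)
    where open ≤-Reasoning

outflow≡inflow : (K : Digraph n) → (∀ v → indeg K v ≡ outdeg K v) → (B : VSet n) →
                 ∑⟨ B ⟩ (λ a → ∑⟨ ∁ B ⟩ (K a)) ≡ ∑⟨ B ⟩ (degFrom K (∁ B))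
outflow≡inflow K balanced B = +-cancelˡ-≡ (∑⟨ B ⟩ (degFrom K B)) (∑⟨ B ⟩ (λ a → ∑⟨ ∁ B ⟩ (K a))) (∑⟨ B ⟩ (degFrom K (∁ B))) (begin
  ∑⟨ B ⟩ (degFrom K B) + ∑⟨ B ⟩ (λ a → ∑⟨ ∁ B ⟩ (K a))        ≡⟨ cong (_+ ∑⟨ B ⟩ (λ a → ∑⟨ ∁ B ⟩ (K a))) (∑⟨⟩-comm B B K) ⟨
  ∑⟨ B ⟩ (λ a → ∑⟨ B ⟩ (K a)) + ∑⟨ B ⟩ (λ a → ∑⟨ ∁ B ⟩ (K a)) ≡⟨ ∑⟨⟩-distrib-+ B (λ a → ∑⟨ B ⟩ (K a)) (λ a → ∑⟨ ∁ B ⟩ (K a)) ⟨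
  ∑⟨ B ⟩ (λ a → ∑⟨ B ⟩ (K a) + ∑⟨ ∁ B ⟩ (K a))                ≡⟨ ∑⟨⟩-cong (λ _ → refl) (λ a _ → degrees a) ⟩
  ∑⟨ B ⟩ (λ a → degFrom K B a + degFrom K (∁ B) a)            ≡⟨ ∑⟨⟩-distrib-+ B (degFrom K B) (degFrom K (∁ B)) ⟩
  ∑⟨ B ⟩ (degFrom K B) + ∑⟨ B ⟩ (degFrom K (∁ B))             ∎)
  where
  open ≡-Reasoning
  degrees : ∀ a → ∑⟨ B ⟩ (K a) + ∑⟨ ∁ B ⟩ (K a) ≡ degFrom K B a + degFrom K (∁ B) a
  degrees a = trans (∑⟨⟩-∁ B (K a)) (trans (sym (outdeg-sum K a)) (trans (sym (balanced a)) (indeg-split K B a)))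

entering-arc : (K : Digraph n) → Eulerian K → (B : VSet n) {u y : Fin n} → B u ≡ true → B y ≡ false →
               ∃ λ v → B v ≡ true × 1 ≤ degFrom K (∁ B) v
entering-arc K (connected , balanced) B {u} {y} u∈B y∉B with crossing-arc K B (connected u y) u∈B y∉B
... | a , b , a∈B , b∉B , a~b = ∑⟨⟩-positive B (degFrom K (∁ B)) (into-B a~b)
  where
  open ≤-Reasoning
  b∈∁B : ∁ B b ≡ true
  b∈∁B = cong not b∉B
  into-B : Adj K a b → 1 ≤ ∑⟨ B ⟩ (degFrom K (∁ B))
  into-B (inj₁ 1≤Kab) = begin
    1                                 ≤⟨ 1≤Kab ⟩
    K a b                             ≤⟨ ≤-∑⟨⟩ (K a) b∈∁B ⟩
    ∑⟨ ∁ B ⟩ (K a)                    ≤⟨ ≤-∑⟨⟩ (λ a → ∑⟨ ∁ B ⟩ (K a)) a∈B ⟩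
    ∑⟨ B ⟩ (λ a → ∑⟨ ∁ B ⟩ (K a))     ≡⟨ outflow≡inflow K balanced B ⟩
    ∑⟨ B ⟩ (degFrom K (∁ B))          ∎
  into-B (inj₂ 1≤Kba) = begin
    1                                 ≤⟨ 1≤Kba ⟩
    K b a                             ≤⟨ ≤-∑⟨⟩ (λ t → K t a) b∈∁B ⟩
    degFrom K (∁ B) a                 ≤⟨ ≤-∑⟨⟩ (degFrom K (∁ B)) a∈B ⟩
    ∑⟨ B ⟩ (degFrom K (∁ B))          ∎

m∸[n∸o]+n≡m+o : ∀ {m n o} → o ≤ n → n ≤ m → m ∸ (n ∸ o) + n ≡ m + o
m∸[n∸o]+n≡m+o {m} {n} {o} o≤n n≤m = begin
  m ∸ (n ∸ o) + n              ≡⟨ cong (m ∸ (n ∸ o) +_) (m∸n+n≡m o≤n) ⟨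
  m ∸ (n ∸ o) + (n ∸ o + o)    ≡⟨ +-assoc (m ∸ (n ∸ o)) (n ∸ o) o ⟨
  m ∸ (n ∸ o) + (n ∸ o) + o    ≡⟨ cong (_+ o) (m∸n+n≡m (≤-trans (m∸n≤m n o) n≤m)) ⟩
  m + o                        ∎
  where open ≡-Reasoning

module GoodConfigurations (K : Digraph n) (s : Fin n) (c : Config n) where
  open ChipFiring K s
  open Firing K s

  Good : Config n → Set
  Good x = ∃ λ y → (c ⊕ (x ⊕ y)) ⇝ c

  Good-0 : Good (λ _ → 0)
  Good-0 = (λ _ → 0) , ≈⇒⇝ (λ u _ → +-identityʳ (c u))

  Good-⊕ : ∀ {x₁ x₂} → Good x₁ → Good x₂ → Good (x₁ ⊕ x₂)
  Good-⊕ {x₁} {x₂} (y₁ , relax₁) (y₂ , relax₂) =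
    (y₁ ⊕ y₂) , ⇝-trans (≈⇒⇝ regroup) (⇝-trans (⇝-⊕ (x₂ ⊕ y₂) relax₁) relax₂)
    where
    regroup : (c ⊕ ((x₁ ⊕ x₂) ⊕ (y₁ ⊕ y₂))) ≈ ((c ⊕ (x₁ ⊕ y₁)) ⊕ (x₂ ⊕ y₂))
    regroup u _ = trans (cong (c u +_) (interchange (x₁ u) (x₂ u) (y₁ u) (y₂ u)))
                        (sym (+-assoc (c u) (x₁ u + y₁ u) (x₂ u + y₂ u)))

  Good-≤ : ∀ {x x′} → (∀ u → u ≢ s → x u ≤ x′ u) → Good x′ → Good x
  Good-≤ {x} {x′} x≤x′ (y , relax) = ((λ u → x′ u ∸ x u) ⊕ y) , ⇝-trans (≈⇒⇝ top-up) relax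
    where
    top-up : (c ⊕ (x ⊕ ((λ u → x′ u ∸ x u) ⊕ y))) ≈ (c ⊕ (x′ ⊕ y))
    top-up u u≢s = cong (c u +_)
      (trans (sym (+-assoc (x u) (x′ u ∸ x u) (y u))) (cong (_+ y u) (m+[n∸m]≡n (x≤x′ u u≢s))))

  Good-* : ∀ {x} m → Good x → Good (λ u → m * x u)
  Good-* zero    _     = Good-0
  Good-* (suc m) good-x = Good-⊕ good-x (Good-* m good-x)

  Good-⇝ : ∀ {x x′} → (c ⊕ x) ⇝ (c ⊕ x′) → Good x′ → Good x
  Good-⇝ {x} {x′} relax (y , relax′) = y ,
    ⇝-trans (≈⇒⇝ λ u _ → sym (+-assoc (c u) (x u) (y u)))
      (⇝-trans (⇝-⊕ y relax) (⇝-trans (≈⇒⇝ λ u _ → +-assoc (c u) (x′ u) (y u)) relax′))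

  Good-supported : ∀ {R x} → Good (𝟙 R) → (∀ u → u ≢ s → R u ≡ false → x u ≡ 0) → Good x
  Good-supported {R} {x} good-R x⊆R = Good-≤ bound (Good-* (sum x) good-R)
    where
    bound : ∀ u → u ≢ s → x u ≤ sum x * 𝟙 R u
    bound u u≢s with R u in eR
    ... | true  = ≤-trans (≤-sum x u) (≤-reflexive (sym (*-identityʳ (sum x))))
    ... | false = ≤-reflexive (trans (x⊆R u u≢s eR) (sym (*-zeroʳ (sum x))))

module Burning (K : Digraph n) (s : Fin n) (eulerian : Eulerian K) {c : Config n}
               (unforbidden : Forbidden.Unforbidden K s c) where
  open ChipFiring K s
  open Firing K s
  open Forbidden K s
  open GoodConfigurations K s c

  β γ : VSet n → Config n
  β A = degFrom K (∁ A) ↾ A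
  γ A = degFrom K A ↾ ∁ A

  module _ (A : VSet n) (s∉A : A s ≡ false) where

    -- The vertices of F ⊆ A have each fired exactly once, starting from c ⊕ β A.
    Burnt : VSet n → Config n → Set
    Burnt F x = Reaches (c ⊕ β A) x × (∀ u → u ≢ s → x u + (outdeg K ↾ F) u ≡ c u + β A u + degFrom K F u)

    burn-step : ∀ {F x v} → F v ≡ false → Firable x v → Burnt F x → Burnt (F ∪ ⁅ v ⁆) (fire x v)
    burn-step {F} {x} {v} v∉F firable@(_ , out≤xv , _) (steps , balance) =
      steps ◅◅ ((v , firable , refl) ◅ ε) , λ u u≢s → balance′ u u≢s (u ≟ v)
      where
      open ≡-Reasoning
      balance′ : ∀ u → u ≢ s → Dec (u ≡ v) →
                 fire x v u + (outdeg K ↾ (F ∪ ⁅ v ⁆)) u ≡ c u + β A u + degFrom K (F ∪ ⁅ v ⁆) u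
      balance′ u u≢s (yes refl) = begin
        fire x u u + (outdeg K ↾ (F ∪ ⁅ u ⁆)) u   ≡⟨ cong₂ _+_ (fire-self x u) (↾-∪⁅⁆-self F u (outdeg K)) ⟩
        x u ∸ (outdeg K u ∸ K u u) + outdeg K u    ≡⟨ m∸[n∸o]+n≡m+o (loops≤outdeg K u) out≤xv ⟩
        x u + K u u                                ≡⟨ cong (λ z → z + K u u) (+-identityʳ (x u)) ⟨
        x u + 0 + K u u                            ≡⟨ cong (λ z → x u + z + K u u) (↾-∉ {P = F} (outdeg K) v∉F) ⟨
        x u + (outdeg K ↾ F) u + K u u             ≡⟨ cong (_+ K u u) (balance u u≢s) ⟩
        c u + β A u + degFrom K F u + K u u        ≡⟨ +-assoc (c u + β A u) (degFrom K F u) (K u u) ⟩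
        c u + β A u + (degFrom K F u + K u u)      ≡⟨ cong (c u + β A u +_) (∑⟨⟩-insert {P = F} (λ t → K t u) v∉F) ⟨
        c u + β A u + degFrom K (F ∪ ⁅ u ⁆) u      ∎
      balance′ u u≢s (no u≢v) = begin
        fire x v u + (outdeg K ↾ (F ∪ ⁅ v ⁆)) u   ≡⟨ cong₂ _+_ (fire-other x u≢v u≢s) (↾-∪⁅⁆-other F (outdeg K) u≢v) ⟩
        x u + K v u + (outdeg K ↾ F) u             ≡⟨ xy∙z≈xz∙y (x u) (K v u) ((outdeg K ↾ F) u) ⟩
        x u + (outdeg K ↾ F) u + K v u             ≡⟨ cong (_+ K v u) (balance u u≢s) ⟩
        c u + β A u + degFrom K F u + K v u        ≡⟨ +-assoc (c u + β A u) (degFrom K F u) (K v u) ⟩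
        c u + β A u + (degFrom K F u + K v u)      ≡⟨ cong (c u + β A u +_) (∑⟨⟩-insert {P = F} (λ t → K t u) v∉F) ⟨
        c u + β A u + degFrom K (F ∪ ⁅ v ⁆) u      ∎

    stuck-forbidden : ∀ {F x} → F ⊆ A → Burnt F x → (∀ v → (A ∖ F) v ≡ true → ¬ Firable x v) →
                      ∃ (λ u → (A ∖ F) u ≡ true) → Forbidden c (A ∖ F)
    stuck-forbidden {F} {x} F⊆A (_ , balance) stuck nonempty = nonempty , A∖F∌s , below
      where
      A∖F∌s : ∀ u → (A ∖ F) u ≡ true → u ≢ s
      A∖F∌s u u∈A∖F refl = contradiction (trans (sym (∖-⊆ {P = A} {Q = F} u u∈A∖F)) s∉A) λ ()
      below : ∀ u → (A ∖ F) u ≡ true → c u < degFrom K (A ∖ F) u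
      below u u∈A∖F = +-cancelˡ-< (outside + fired) (c u) (degFrom K (A ∖ F) u) (begin-strict
        outside + fired + c u                          ≡⟨ +-comm (outside + fired) (c u) ⟩
        c u + (outside + fired)                        ≡⟨ +-assoc (c u) outside fired ⟨
        c u + outside + fired                          ≡⟨ cong (λ z → c u + z + fired) (↾-∈ {P = A} (degFrom K (∁ A)) u∈A) ⟨
        c u + β A u + fired                            ≡⟨ balance u u≢s ⟨
        x u + (outdeg K ↾ F) u                         ≡⟨ cong (x u +_) (↾-∉ {P = F} (outdeg K) u∉F) ⟩
        x u + 0                                        ≡⟨ +-identityʳ (x u) ⟩
        x u                                            <⟨ ≰⇒> (λ out≤xu → stuck u u∈A∖F (u≢s , out≤xu , outdeg∸loops-positive K eulerian u≢s)) ⟩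
        outdeg K u                                     ≡⟨ proj₂ eulerian u ⟨
        indeg K u                                      ≡⟨ indeg-sum K u ⟩
        sum (λ t → K t u)                              ≡⟨ ∑⟨⟩-partition (λ t → K t u) F⊆A ⟨
        outside + fired + degFrom K (A ∖ F) u          ∎)
        where
        open ≤-Reasoning
        u≢s : u ≢ s
        u≢s = A∖F∌s u u∈A∖F
        u∈A : A u ≡ true
        u∈A = ∖-⊆ {P = A} {Q = F} u u∈A∖F
        u∉F : F u ≡ false
        u∉F = ∖-∉ {P = A} {Q = F} u∈A∖F
        outside fired : ℕ
        outside = degFrom K (∁ A) u
        fired = degFrom K F u

    burn-extend : ∀ F → F ⊆ A → ∃ (Burnt F) → ∃ (λ u → (A ∖ F) u ≡ true) →
                  ∃ λ v → (A ∖ F) v ≡ true × ∃ (Burnt (F ∪ ⁅ v ⁆))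
    burn-extend F F⊆A (x , burnt) nonempty with any? (λ v → ((A ∖ F) v ≟ᵇ true) ×-dec firable? x v)
    ... | yes (v , v∈A∖F , firable) = v , v∈A∖F , fire x v , burn-step (∖-∉ {P = A} {Q = F} v∈A∖F) firable burnt
    ... | no stuck = contradiction
      (stuck-forbidden F⊆A burnt (λ v v∈A∖F firable → stuck (v , v∈A∖F , firable)) nonempty) (unforbidden (A ∖ F))

    burnt-∅ : Burnt ∅ (c ⊕ β A)
    burnt-∅ = ε , λ u _ → cong (c u + β A u +_) (sym (∑⟨∅⟩ {n} (λ t → K t u)))

    burn : (c ⊕ β A) ⇝ (c ⊕ γ A)
    burn with saturate A (λ F → ∃ (Burnt F)) burn-extend (c ⊕ β A , burnt-∅)
    ... | F , F≗A , x , steps , balance = x , steps , λ u u≢s → burnt-all u (balance-A u u≢s)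
      where
      balance-A : ∀ u → u ≢ s → x u + (outdeg K ↾ A) u ≡ c u + β A u + degFrom K A u
      balance-A u u≢s = trans (cong (λ b → x u + (if b then outdeg K u else 0)) (sym (F≗A u)))
        (trans (balance u u≢s) (cong (c u + β A u +_) (∑⟨⟩-cong F≗A λ _ _ → refl)))
      burnt-all : ∀ u → x u + (outdeg K ↾ A) u ≡ c u + β A u + degFrom K A u → x u ≡ c u + γ A u
      burnt-all u eq with A u
      ... | true  = +-cancelʳ-≡ (outdeg K u) (x u) (c u + 0) (begin
        x u + outdeg K u                                  ≡⟨ eq ⟩
        c u + degFrom K (∁ A) u + degFrom K A u           ≡⟨ +-assoc (c u) (degFrom K (∁ A) u) (degFrom K A u) ⟩
        c u + (degFrom K (∁ A) u + degFrom K A u)         ≡⟨ cong (c u +_) (+-comm (degFrom K (∁ A) u) (degFrom K A u)) ⟩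
        c u + (degFrom K A u + degFrom K (∁ A) u)         ≡⟨ cong (c u +_) (indeg-split K A u) ⟨
        c u + indeg K u                                   ≡⟨ cong (c u +_) (proj₂ eulerian u) ⟩
        c u + outdeg K u                                  ≡⟨ cong (_+ outdeg K u) (+-identityʳ (c u)) ⟨
        c u + 0 + outdeg K u                              ∎)
        where open ≡-Reasoning
      ... | false = trans (sym (+-identityʳ (x u))) (trans eq (cong (_+ degFrom K A u) (+-identityʳ (c u))))

  nonsink : VSet n
  nonsink = ∁ ⁅ s ⁆

  s∉nonsink∖ : ∀ R → (nonsink ∖ R) s ≡ false
  s∉nonsink∖ R rewrite ⁅⁆-self s = refl

  grow-good : ∀ R → R ⊆ nonsink → Good (𝟙 R) → ∃ (λ u → (nonsink ∖ R) u ≡ true) →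
              ∃ λ v → (nonsink ∖ R) v ≡ true × Good (𝟙 (R ∪ ⁅ v ⁆))
  grow-good R _ good-R (u , u∈B) with entering-arc K eulerian (nonsink ∖ R) u∈B (s∉nonsink∖ R)
  ... | v , v∈B , 1≤βv = v , v∈B , Good-≤ (λ t _ → 𝟙-∪ R ⁅ v ⁆ t) (Good-⊕ good-R good-v)
    where
    B : VSet n
    B = nonsink ∖ R
    good-γ : Good (γ B)
    good-γ = Good-supported good-R λ t t≢s t∉R → ↾-∉ {P = ∁ B} (degFrom K B) (t∉∁B t≢s t∉R)
      where
      t∉∁B : ∀ {t} → t ≢ s → R t ≡ false → ∁ B t ≡ false
      t∉∁B t≢s t∉R rewrite ⁅⁆-other t≢s | t∉R = refl
    good-v : Good (𝟙 ⁅ v ⁆)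
    good-v = Good-≤ below-β (Good-⇝ (burn B (s∉nonsink∖ R)) good-γ)
      where
      below-β : ∀ t → t ≢ s → 𝟙 ⁅ v ⁆ t ≤ β B t
      below-β t _ with t ≟ v
      ... | yes refl = ≤-trans 1≤βv (≤-reflexive (sym (↾-∈ {P = B} (degFrom K (∁ B)) v∈B)))
      ... | no _     = z≤n

  everything-good : ∀ x → Good x
  everything-good x with saturate nonsink (λ R → Good (𝟙 R)) grow-good Good-0
  ... | R , R≗nonsink , good-R = Good-supported good-R λ u u≢s u∉R →
    contradiction (trans (sym u∉R) (trans (R≗nonsink u) (cong not (⁅⁆-other u≢s)))) λ ()

  stable⇒recurrent : Stable c → Recurrent c
  stable⇒recurrent c-stable = c-stable , λ d → reach-c d (everything-good d)
    where
    reach-c : ∀ d → Good d → ∃ λ d′ → StabilizesTo (d ⊕ d′) c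
    reach-c d (y , relax) with ⇝-trans (≈⇒⇝ λ u _ → x∙yz≈y∙xz (d u) (c u) (y u)) relax
    ... | c′ , steps , c′≈c = (c ⊕ y) , c′ , steps , stable-cong (≈-sym c′≈c) c-stable , c′≈c

recurrent⇔stable×unforbidden : (K : Digraph n) (s : Fin n) → Eulerian K → (c : Config n) →
  ChipFiring.Recurrent K s c ⇔ (ChipFiring.Stable K s c × Forbidden.Unforbidden K s c)
recurrent⇔stable×unforbidden K s eulerian c = mk⇔
  (λ recurrent → proj₁ recurrent , Forbidden.recurrent⇒unforbidden K s recurrent)
  (λ (stable , unforbidden) → Burning.stable⇒recurrent K s eulerian unforbidden stable)

stable⇔below-outdeg : (K : Digraph n) (s : Fin n) → Eulerian K → (c : Config n) →
  ChipFiring.Stable K s c ⇔ (∀ v → v ≢ s → c v < outdeg K v)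
stable⇔below-outdeg K s eulerian c = mk⇔
  (λ stable v v≢s → ≰⇒> λ out≤cv → stable v (v≢s , out≤cv , outdeg∸loops-positive K eulerian v≢s))
  (λ below v (v≢s , out≤cv , _) → <⇒≱ (below v v≢s) out≤cv)

module RemoveTwoCycle (G : Digraph n) {s w : Fin n} (w≢s : w ≢ s) (1≤Gsw : 1 ≤ G s w) (1≤Gws : 1 ≤ G w s) where

  G₁ H : Digraph n
  G₁ = removeArc G s w
  H = removeArc G₁ w s

  1≤G₁ws : 1 ≤ G₁ w s
  1≤G₁ws = subst (1 ≤_) (sym (removeArc-other G {s} {w} {w} {s} (w≢s ∘ proj₁))) 1≤Gws

  H-away-from-s : ∀ {x y} → x ≢ s → y ≢ s → H x y ≡ G x y
  H-away-from-s {x} {y} x≢s y≢s =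
    trans (removeArc-other G₁ {w} {s} {x} {y} (y≢s ∘ proj₂)) (removeArc-other G {s} {w} {x} {y} (x≢s ∘ proj₁))

  outdeg-H : ∀ x → outdeg H x + 𝟙 ⁅ w ⁆ x + 𝟙 ⁅ s ⁆ x ≡ outdeg G x
  outdeg-H x = trans (cong (_+ 𝟙 ⁅ s ⁆ x) (outdeg-removeArc G₁ 1≤G₁ws x)) (outdeg-removeArc G 1≤Gsw x)

  indeg-H : ∀ y → indeg H y + 𝟙 ⁅ s ⁆ y + 𝟙 ⁅ w ⁆ y ≡ indeg G y
  indeg-H y = trans (cong (_+ 𝟙 ⁅ w ⁆ y) (indeg-removeArc G₁ 1≤G₁ws y)) (indeg-removeArc G 1≤Gsw y)

  H-eulerian : Eulerian G → Connected H → Eulerian H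
  H-eulerian (_ , balanced) connected = connected , λ v → +-cancelʳ-≡ (𝟙 ⁅ w ⁆ v + 𝟙 ⁅ s ⁆ v) _ _ (begin
    indeg H v + (𝟙 ⁅ w ⁆ v + 𝟙 ⁅ s ⁆ v)    ≡⟨ x∙yz≈xz∙y (indeg H v) (𝟙 ⁅ w ⁆ v) (𝟙 ⁅ s ⁆ v) ⟩
    indeg H v + 𝟙 ⁅ s ⁆ v + 𝟙 ⁅ w ⁆ v      ≡⟨ indeg-H v ⟩
    indeg G v                              ≡⟨ balanced v ⟩
    outdeg G v                             ≡⟨ outdeg-H v ⟨
    outdeg H v + 𝟙 ⁅ w ⁆ v + 𝟙 ⁅ s ⁆ v     ≡⟨ +-assoc (outdeg H v) (𝟙 ⁅ w ⁆ v) (𝟙 ⁅ s ⁆ v) ⟩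
    outdeg H v + (𝟙 ⁅ w ⁆ v + 𝟙 ⁅ s ⁆ v)   ∎)
    where open ≡-Reasoning

  outdeg-G-w : outdeg G w ≡ suc (outdeg H w)
  outdeg-G-w = begin
    outdeg G w                               ≡⟨ outdeg-H w ⟨
    outdeg H w + 𝟙 ⁅ w ⁆ w + 𝟙 ⁅ s ⁆ w       ≡⟨ cong₂ (λ x y → outdeg H w + x + y) (𝟙⁅⁆-self w) (𝟙⁅⁆-other w≢s) ⟩
    outdeg H w + 1 + 0                       ≡⟨ +-identityʳ _ ⟩
    outdeg H w + 1                           ≡⟨ +-comm (outdeg H w) 1 ⟩
    suc (outdeg H w)                         ∎
    where open ≡-Reasoning

  outdeg-H-other : ∀ {v} → v ≢ s → v ≢ w → outdeg H v ≡ outdeg G v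
  outdeg-H-other {v} v≢s v≢w = begin
    outdeg H v                               ≡⟨ +-identityʳ _ ⟨
    outdeg H v + 0                           ≡⟨ +-identityʳ _ ⟨
    outdeg H v + 0 + 0                       ≡⟨ cong₂ (λ x y → outdeg H v + x + y) (𝟙⁅⁆-other v≢w) (𝟙⁅⁆-other v≢s) ⟨
    outdeg H v + 𝟙 ⁅ w ⁆ v + 𝟙 ⁅ s ⁆ v       ≡⟨ outdeg-H v ⟩
    outdeg G v                               ∎
    where open ≡-Reasoning

  below-outdeg-H⇔ : (c : Config n) → (∀ v → v ≢ s → c v < outdeg H v) ⇔
                          ((∀ v → v ≢ s → c v < outdeg G v) × suc (c w) < outdeg G w)
  below-outdeg-H⇔ c = mk⇔ to from
    where
    to : (∀ v → v ≢ s → c v < outdeg H v) → (∀ v → v ≢ s → c v < outdeg G v) × suc (c w) < outdeg G w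
    to below-H = below-G , at-w
      where
      at-w : suc (c w) < outdeg G w
      at-w = subst (suc (c w) <_) (sym outdeg-G-w) (s≤s (below-H w w≢s))
      below-G : ∀ v → v ≢ s → c v < outdeg G v
      below-G v v≢s = by-cases (v ≟ w)
        where
        by-cases : Dec (v ≡ w) → c v < outdeg G v
        by-cases (yes refl) = <-trans (n<1+n (c v)) at-w
        by-cases (no v≢w)   = subst (c v <_) (outdeg-H-other v≢s v≢w) (below-H v v≢s)
    from : (∀ v → v ≢ s → c v < outdeg G v) × suc (c w) < outdeg G w → ∀ v → v ≢ s → c v < outdeg H v
    from (below-G , at-w) v v≢s = by-cases (v ≟ w)
      where
      by-cases : Dec (v ≡ w) → c v < outdeg H v
      by-cases (yes refl) = s≤s⁻¹ (subst (suc (c v) <_) outdeg-G-w at-w)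
      by-cases (no v≢w)   = subst (c v <_) (sym (outdeg-H-other v≢s v≢w)) (below-G v v≢s)

  forbidden-H⇔G : (c : Config n) (T : VSet n) → Forbidden.Forbidden H s c T ⇔ Forbidden.Forbidden G s c T
  forbidden-H⇔G c T = mk⇔
    (λ (nonempty , T∌s , below) → nonempty , T∌s , λ u u∈T →
      subst (c u <_) (degFrom-H≡G T∌s (T∌s u u∈T)) (below u u∈T))
    (λ (nonempty , T∌s , below) → nonempty , T∌s , λ u u∈T →
      subst (c u <_) (sym (degFrom-H≡G T∌s (T∌s u u∈T))) (below u u∈T))
    where
    degFrom-H≡G : ∀ {u} → (∀ t → T t ≡ true → t ≢ s) → u ≢ s → degFrom H T u ≡ degFrom G T u
    degFrom-H≡G T∌s u≢s = ∑⟨⟩-cong (λ _ → refl) λ t t∈T → H-away-from-s (T∌s t t∈T) u≢s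

  unforbidden-H⇔G : (c : Config n) → Forbidden.Unforbidden H s c ⇔ Forbidden.Unforbidden G s c
  unforbidden-H⇔G c = mk⇔
    (λ unforbidden-H T → unforbidden-H T ∘ Equivalence.from (forbidden-H⇔G c T))
    (λ unforbidden-G T → unforbidden-G T ∘ Equivalence.to (forbidden-H⇔G c T))

  stable-H⇔ : Eulerian G → Eulerian H → (c : Config n) →
              ChipFiring.Stable H s c ⇔ (ChipFiring.Stable G s c × suc (c w) < outdeg G w)
  stable-H⇔ eulerian-G eulerian-H c =
    ⇔-trans (stable⇔below-outdeg H s eulerian-H c)
      (⇔-trans (below-outdeg-H⇔ c) (⇔-sym (stable⇔below-outdeg G s eulerian-G c) ×-⇔ ⇔-refl))

lemma13 : {n : ℕ} (G : Digraph n) (s w : Fin n) →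
          Eulerian G → w ≢ s → 1 ≤ G s w → 1 ≤ G w s →
          Connected (removeArc (removeArc G s w) w s) →
          (c : Config n) →
          (ChipFiring.Recurrent G s c × suc (c w) < outdeg G w)
            ⇔ ChipFiring.Recurrent (removeArc (removeArc G s w) w s) s c
lemma13 G s w eulerian-G w≢s 1≤Gsw 1≤Gws connected-H c = begin
  (Recurrent G s c × suc (c w) < outdeg G w)                    ∼⟨ recurrent⇔stable×unforbidden G s eulerian-G c ×-⇔ ⇔-refl ⟩
  ((Stable G s c × Unforbidden G s c) × suc (c w) < outdeg G w) ∼⟨ mk⇔ regroup regroup⁻¹ ⟩
  ((Stable G s c × suc (c w) < outdeg G w) × Unforbidden G s c) ∼⟨ ⇔-sym (stable-H⇔ eulerian-G eulerian-H c) ×-⇔ ⇔-sym (unforbidden-H⇔G c) ⟩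
  (Stable H s c × Unforbidden H s c)                            ∼⟨ ⇔-sym (recurrent⇔stable×unforbidden H s eulerian-H c) ⟩
  Recurrent H s c                                               ∎
  where
  open RemoveTwoCycle G w≢s 1≤Gsw 1≤Gws
  open ChipFiring using (Recurrent; Stable)
  open Forbidden using (Unforbidden)
  open EquationalReasoning
  eulerian-H : Eulerian H
  eulerian-H = H-eulerian eulerian-G connected-H
  regroup : ∀ {A B C : Set} → (A × B) × C → (A × C) × B
  regroup ((x , y) , z) = (x , z) , y
  regroup⁻¹ : ∀ {A B C : Set} → (A × C) × B → (A × B) × C
  regroup⁻¹ ((x , z) , y) = (x , y) , z
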